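{- Let $n$ be a positive multiple of $3$, let $k$ be an integer with $n/3<k<n/2$, and let $\Pi$ be a $3$-decomposable halfperiod on $n$ points with $\pi_0=(a_1,\dots,a_{n/3},b_1,\dots,b_{n/3},c_1,\dots,c_{n/3})$. Let $D_k$ be the digraph on vertex set $\{1,2,\dots,n/3\}$ with a directed edge $i\to j$ if and only if $i<j$ and the transposition of $a_i$ and $a_j$ in $\Pi$ occurs in the $k$-center. Then for every vertex $i$ of $D_k$, \[ [i]^{+}\leq\min\{\,n-2k-1+[i]^{ - },\;n/3-i\,\}, \] where $[i]^+$ and $[i]^-$ denote the outdegree and indegree of $i$ in $D_k$.
   Context: A halfperiod on $n$ points is a sequence $\Pi=(\pi_0,\dots,\pi_{\binom n2})$ of permutations of an $n$-element set such that consecutive permutations differ by a transposition of two elements in adjacent positions and $\pi_{\binom n2}$ is the reverse of $\pi_0$ (each pair is transposed exactly once). $\Pi$ is $3$-decomposable if its elements can be labeled $A=\{a_1,\dots,a_{n/3}\}$, $B=\{b_1,\dots,b_{n/3}\}$, $C=\{c_1,\dots,c_{n/3}\}$ so that $\pi_0=(a_1,\dots,a_{n/3},b_1,\dots,b_{n/3},c_1,\dots,c_{n/3})$ and for some $0<s<t\le\binom n2$, $\pi_{s+1}$ lists all of $B$, then $A$, then $C$, and $\pi_{t+1}$ lists all of $B$, then $C$, then $A$. A transposition between the elements in positions $i$ and $i+1$ with $k<i<n-k$ is said to occur in the $k$-center. -}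

module Defs where

open import Data.Nat using (ℕ; zero; suc; _+_; _*_; _∸_; _≤_; _<_; _⊓_; _≟_; _<?_; _≤?_)
open import Data.Nat.Combinatorics using (_C_)
open import Data.Fin using (Fin; toℕ)
import Data.Fin as F
open import Data.Fin.Properties using (any?)
open import Data.Product using (Σ; _×_; _,_; ∃)
open import Data.Sum using (_⊎_)
open import Data.List using (List; length; filter; upTo)
open import Relation.Binary.PropositionalEquality using (_≡_)
open import Relation.Nullary using (Dec; yes; no)
open import Relation.Nullary.Decidable using (_×-dec_; _⊎-dec_)
open import Function.Definitions using (Injective)

-- A permutation of the n points (the points are Fin n) is represented as a map
-- position ↦ element, Fin n → Fin n (required to be injective, hence bijective).

swapℕ : ℕ → ℕ → ℕ
swapℕ p q with q ≟ p | q ≟ suc p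
... | yes _ | _     = suc p
... | no _  | yes _ = p
... | no _  | no _  = q

AdjStep : ∀ {n} → (Fin n → Fin n) → (Fin n → Fin n) → ℕ → Set
AdjStep {n} σ τ p = suc p < n × (∀ (q q' : Fin n) → toℕ q' ≡ swapℕ p (toℕ q) → τ q ≡ σ q')

Reverses : ∀ {n} → (Fin n → Fin n) → (Fin n → Fin n) → Set
Reverses {n} σ τ = ∀ (q q' : Fin n) → suc (toℕ q + toℕ q') ≡ n → τ q ≡ σ q'

record Halfperiod (n : ℕ) : Set where
  field
    π    : ℕ → Fin n → Fin n
    pos  : ℕ → ℕ
    perm : ∀ t → t ≤ n C 2 → Injective _≡_ _≡_ (π t)
    step : ∀ t → t < n C 2 → AdjStep (π t) (π (suc t)) (pos t)
    rev  : Reverses (π 0) (π (n C 2))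

module _ (m : ℕ) (H : Halfperiod (3 * m)) where
  open Halfperiod H

  -- Block b ∈ {0,1,2} (= A, B, C) of the labelling induced by π 0:
  -- x is in block b iff x sits in π 0 at a position in [b*m, (b+1)*m).
  InBlock : ℕ → Fin (3 * m) → Set
  InBlock b x = Σ (Fin (3 * m)) λ q → π 0 q ≡ x × b * m ≤ toℕ q × toℕ q < suc b * m

  ListsBlocks : (Fin (3 * m) → Fin (3 * m)) → ℕ → ℕ → ℕ → Set
  ListsBlocks σ b₀ b₁ b₂ = ∀ (q : Fin (3 * m)) →
    (toℕ q < m → InBlock b₀ (σ q)) ×
    (m ≤ toℕ q → toℕ q < 2 * m → InBlock b₁ (σ q)) ×
    (2 * m ≤ toℕ q → InBlock b₂ (σ q))

  ThreeDecomposable : Set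
  ThreeDecomposable = Σ ℕ λ s → Σ ℕ λ t →
    0 < s × s < t × suc t ≤ (3 * m) C 2 ×
    ListsBlocks (π (suc s)) 1 0 2 × ListsBlocks (π (suc t)) 1 2 0

  Swapped : Fin (3 * m) → Fin (3 * m) → ℕ → Set
  Swapped x y t = Σ (Fin (3 * m)) λ q → Σ (Fin (3 * m)) λ q' →
    toℕ q ≡ pos t × toℕ q' ≡ suc (pos t) ×
    ((π t q ≡ x × π t q' ≡ y) ⊎ (π t q ≡ y × π t q' ≡ x))

  -- The transposition at 0-indexed positions p, p+1 (1-indexed i = p+1, i+1)
  -- occurs in the k-center iff k < i < n - k.
  InCenter : ℕ → ℕ → Set
  InCenter k p = k < suc p × suc p < 3 * m ∸ k

  OccursInCenter : ℕ → Fin (3 * m) → Fin (3 * m) → Set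
  OccursInCenter k x y = Σ (Fin ((3 * m) C 2)) λ t →
    Swapped x y (toℕ t) × InCenter k (pos (toℕ t))

  -- Edge i → j of D_k (vertices 1..m, a_i = π 0 at 0-indexed position i-1).
  Edge : ℕ → ℕ → ℕ → Set
  Edge k i j = i < j × j ≤ m × (Σ (Fin (3 * m)) λ qi → Σ (Fin (3 * m)) λ qj →
    suc (toℕ qi) ≡ i × suc (toℕ qj) ≡ j × OccursInCenter k (π 0 qi) (π 0 qj))

  swapped? : ∀ x y t → Dec (Swapped x y t)
  swapped? x y t = any? λ q → any? λ q' →
    (toℕ q ≟ pos t) ×-dec (toℕ q' ≟ suc (pos t)) ×-dec
    (((π t q F.≟ x) ×-dec (π t q' F.≟ y)) ⊎-dec ((π t q F.≟ y) ×-dec (π t q' F.≟ x)))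

  occurs? : ∀ k x y → Dec (OccursInCenter k x y)
  occurs? k x y = any? λ t → swapped? x y (toℕ t) ×-dec
    ((k <? suc (pos (toℕ t))) ×-dec (suc (pos (toℕ t)) <? 3 * m ∸ k))

  edge? : ∀ k i j → Dec (Edge k i j)
  edge? k i j = (i <? j) ×-dec (j ≤? m) ×-dec (any? λ qi → any? λ qj →
    (suc (toℕ qi) ≟ i) ×-dec (suc (toℕ qj) ≟ j) ×-dec occurs? k (π 0 qi) (π 0 qj))

  -- out- and in-degree of vertex i in D_k (candidates 0..m; 0 is never a vertex).
  outdeg : ℕ → ℕ → ℕ
  outdeg k i = length (filter (λ j → edge? k i j) (upTo (suc m)))

  indeg : ℕ → ℕ → ℕ
  indeg k i = length (filter (λ j → edge? k j i) (upTo (suc m)))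

module Submission where

-- Follow the element a_i, at position i - 1 < k of π 0, through the halfperiod. The number of
-- pairs inverted relative to π 0 is 0 at the start, n C 2 at the end and changes by one per
-- step, so every step transposes a pair still in its π 0 order. Hence each out-edge i → j is a
-- centre step moving a_i to the right, while each centre step moving a_i to the left passes an
-- element preceding a_i in π 0, i.e. an in-neighbour a_l with l < i, and never the same one
-- twice (afterwards a_i stays left of it). As a_i starts left of the k-center and ends at
-- position n - i, right of it, its right centre moves outnumber its left ones by exactly the
-- n - 2k - 1 centre steps. The bound n/3 - i holds as all out-neighbours lie in i+1 .. n/3.

open import Defs
open import Function using (_∘_)
open import Data.Nat
open import Data.Nat.Properties
open import Data.Nat.Combinatorics using (_C_; nC1≡n; nCk+nC[k+1]≡[n+1]C[k+1])
open import Data.Nat.Tactic.RingSolver using (solve-∀)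
open import Data.Fin using (Fin; toℕ; fromℕ<)
open import Data.Fin.Properties using (toℕ-fromℕ<; toℕ-injective; toℕ<n)
open import Data.Product using (Σ; ∃; _×_; _,_; proj₁; proj₂)
open import Data.Sum using (inj₁; inj₂)
open import Data.List using (List; []; _∷_; [_]; _++_; length; filter; upTo)
open import Data.List.Properties using (upTo-∷ʳ; filter-++; length-++; length-upTo)
open import Data.List.Membership.Propositional using (_∈_)
open import Data.List.Membership.Propositional.Properties using (∈-filter⁺; ∈-filter⁻; ∈-upTo⁺; ∈-upTo⁻)
open import Data.List.Relation.Unary.Any using (here; there)
open import Data.List.Relation.Unary.All as All using ()
open import Data.List.Relation.Unary.AllPairs using (_∷_)
open import Data.List.Relation.Unary.Unique.Propositional using (Unique)
open import Data.List.Relation.Unary.Unique.Propositional.Properties using (filter⁺; upTo⁺)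
open import Relation.Binary.PropositionalEquality hiding ([_])
open import Relation.Binary.Definitions using (tri<; tri≈; tri>)
open import Relation.Nullary using (Dec; yes; no; ¬_; contradiction)
open import Relation.Nullary.Decidable using (_×-dec_)
open import Relation.Unary using (Decidable)

-- Indicators and adjacent transpositions

𝟙 : ∀ {a} {A : Set a} → Dec A → ℕ
𝟙 (yes _) = 1
𝟙 (no _)  = 0

𝟙-yes : ∀ {a} {A : Set a} (A? : Dec A) → A → 𝟙 A? ≡ 1
𝟙-yes (yes _) _ = refl
𝟙-yes (no ¬a) a = contradiction a ¬a

𝟙-no : ∀ {a} {A : Set a} (A? : Dec A) → ¬ A → 𝟙 A? ≡ 0
𝟙-no (yes a) ¬a = contradiction a ¬a
𝟙-no (no _)  _  = refl

𝟙-cong : ∀ {a b} {A : Set a} {B : Set b} (A? : Dec A) (B? : Dec B) → (A → B) → (B → A) → 𝟙 A? ≡ 𝟙 B?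
𝟙-cong (yes _) (yes _) _ _ = refl
𝟙-cong (yes a) (no ¬b) f _ = contradiction (f a) ¬b
𝟙-cong (no ¬a) (yes b) _ g = contradiction (g b) ¬a
𝟙-cong (no _)  (no _)  _ _ = refl

𝟙≤1 : ∀ {a} {A : Set a} (A? : Dec A) → 𝟙 A? ≤ 1
𝟙≤1 (yes _) = s≤s z≤n
𝟙≤1 (no _)  = z≤n

data SwapℕView (p : ℕ) : ℕ → ℕ → Set where
  left  : SwapℕView p p (suc p)
  right : SwapℕView p (suc p) p
  other : ∀ {q} → q ≢ p → q ≢ suc p → SwapℕView p q q

swapℕ-view : ∀ p q → SwapℕView p q (swapℕ p q)
swapℕ-view p q with q ≟ p | q ≟ suc p
... | yes refl | _        = left
... | no _     | yes refl = right
... | no q≢p   | no q≢1+p = other q≢p q≢1+p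

swapℕ-left : ∀ p → swapℕ p p ≡ suc p
swapℕ-left p with swapℕ p p | swapℕ-view p p
... | _ | left        = refl
... | _ | other p≢p _ = contradiction refl p≢p

swapℕ-right : ∀ p → swapℕ p (suc p) ≡ p
swapℕ-right p with swapℕ p (suc p) | swapℕ-view p (suc p)
... | _ | right           = refl
... | _ | other _ 1+p≢1+p = contradiction refl 1+p≢1+p

swapℕ-other : ∀ p {q} → q ≢ p → q ≢ suc p → swapℕ p q ≡ q
swapℕ-other p {q} q≢p q≢1+p with swapℕ p q | swapℕ-view p q
... | _ | left      = contradiction refl q≢p
... | _ | right     = contradiction refl q≢1+p
... | _ | other _ _ = refl

swapℕ-involutive : ∀ p q → swapℕ p (swapℕ p q) ≡ q
swapℕ-involutive p q with swapℕ p q | swapℕ-view p q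
... | _ | left              = swapℕ-right p
... | _ | right             = swapℕ-left p
... | _ | other q≢p q≢1+p  = swapℕ-other p q≢p q≢1+p

swapℕ-injective : ∀ p {x y} → swapℕ p x ≡ swapℕ p y → x ≡ y
swapℕ-injective p {x} {y} eq = begin
  x                         ≡⟨ swapℕ-involutive p x ⟨
  swapℕ p (swapℕ p x)       ≡⟨ cong (swapℕ p) eq ⟩
  swapℕ p (swapℕ p y)       ≡⟨ swapℕ-involutive p y ⟩
  y                         ∎
  where open ≡-Reasoning

swapℕ-< : ∀ {n} p {q} → suc p < n → q < n → swapℕ p q < n
swapℕ-< p {q} 2+p≤n q<n with swapℕ p q | swapℕ-view p q
... | _ | left      = 2+p≤n
... | _ | right     = <-trans (n<1+n p) 2+p≤n
... | _ | other _ _ = q<n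

swapℕ-mono-< : ∀ p {x y} → x < y → ¬ (x ≡ p × y ≡ suc p) → swapℕ p x < swapℕ p y
swapℕ-mono-< p {x} {y} x<y ¬pair
  with swapℕ p x | swapℕ-view p x | swapℕ p y | swapℕ-view p y
... | _ | left  | _ | left  = contradiction x<y (<-irrefl refl)
... | _ | left  | _ | right = contradiction (refl , refl) ¬pair
... | _ | left  | _ | other _ y≢1+p = ≤∧≢⇒< x<y (y≢1+p ∘ sym)
... | _ | right | _ | left  = contradiction x<y (<-asym (n<1+n p))
... | _ | right | _ | right = contradiction x<y (<-irrefl refl)
... | _ | right | _ | other _ _ = <-trans (n<1+n p) x<y
... | _ | other _ _ | _ | left  = <-trans x<y (n<1+n p)
... | _ | other x≢p _ | _ | right = ≤∧≢⇒< (≤-pred x<y) x≢p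
... | _ | other _ _ | _ | other _ _ = x<y

swapℕ-reflects-< : ∀ p {x y} → ¬ (x ≡ suc p × y ≡ p) → swapℕ p x < swapℕ p y → x < y
swapℕ-reflects-< p {x} {y} ¬reversedPair sx<sy =
  subst₂ _<_ (swapℕ-involutive p x) (swapℕ-involutive p y) (swapℕ-mono-< p sx<sy ¬pair)
  where
  ¬pair : ¬ (swapℕ p x ≡ p × swapℕ p y ≡ suc p)
  ¬pair (sx≡p , sy≡1+p) = ¬reversedPair
    ( trans (sym (swapℕ-involutive p x)) (trans (cong (swapℕ p) sx≡p) (swapℕ-left p))
    , trans (sym (swapℕ-involutive p y)) (trans (cong (swapℕ p) sy≡1+p) (swapℕ-right p)))

-- The order of two points changes under swapℕ p exactly for the pair (p, p+1).
swapℕ-<-indicator : ∀ p x y →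
  𝟙 (swapℕ p x <? swapℕ p y) + 𝟙 ((x ≟ p) ×-dec (y ≟ suc p)) ≡
  𝟙 (x <? y) + 𝟙 ((x ≟ suc p) ×-dec (y ≟ p))
swapℕ-<-indicator p x y with (x ≟ p) ×-dec (y ≟ suc p) | (x ≟ suc p) ×-dec (y ≟ p)
... | yes (refl , refl) | yes (() , _)
... | yes (refl , refl) | no _
  rewrite swapℕ-left p | swapℕ-right p
        | 𝟙-no (suc p <? p) (<-asym (n<1+n p)) | 𝟙-yes (p <? suc p) (n<1+n p) = refl
... | no _ | yes (refl , refl)
  rewrite swapℕ-left p | swapℕ-right p
        | 𝟙-no (suc p <? p) (<-asym (n<1+n p)) | 𝟙-yes (p <? suc p) (n<1+n p) = refl
... | no ¬pair | no ¬reversedPair =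
  cong (_+ 0) (𝟙-cong (swapℕ p x <? swapℕ p y) (x <? y)
    (swapℕ-reflects-< p ¬reversedPair) (λ x<y → swapℕ-mono-< p x<y ¬pair))

-- Finite sums and inversion counts

sumBelow : ℕ → (ℕ → ℕ) → ℕ
sumBelow zero    f = 0
sumBelow (suc n) f = sumBelow n f + f n

sumBelow-cong : ∀ n {f g : ℕ → ℕ} → (∀ x → x < n → f x ≡ g x) → sumBelow n f ≡ sumBelow n g
sumBelow-cong zero    f≡g = refl
sumBelow-cong (suc n) f≡g =
  cong₂ _+_ (sumBelow-cong n λ x x<n → f≡g x (m<n⇒m<1+n x<n)) (f≡g n (n<1+n n))

sumBelow-≡0 : ∀ n {f : ℕ → ℕ} → (∀ x → x < n → f x ≡ 0) → sumBelow n f ≡ 0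
sumBelow-≡0 zero    f≡0 = refl
sumBelow-≡0 (suc n) f≡0 =
  cong₂ _+_ (sumBelow-≡0 n λ x x<n → f≡0 x (m<n⇒m<1+n x<n)) (f≡0 n (n<1+n n))

sumBelow-single : ∀ n {f : ℕ → ℕ} {a} → a < n → (∀ x → x < n → x ≢ a → f x ≡ 0) →
                  sumBelow n f ≡ f a
sumBelow-single (suc n) {f} {a} a<1+n f≡0 with a ≟ n
... | yes refl = cong (_+ f a) (sumBelow-≡0 n λ x x<n → f≡0 x (m<n⇒m<1+n x<n) (<⇒≢ x<n))
... | no a≢n   = begin
  sumBelow n f + f n ≡⟨ cong₂ _+_ (sumBelow-single n a<n f≡0′) (f≡0 n (n<1+n n) (a≢n ∘ sym)) ⟩
  f a + 0            ≡⟨ +-identityʳ (f a) ⟩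
  f a                ∎
  where
  open ≡-Reasoning
  a<n : a < n
  a<n = ≤∧≢⇒< (≤-pred a<1+n) a≢n
  f≡0′ : ∀ x → x < n → x ≢ a → f x ≡ 0
  f≡0′ x x<n = f≡0 x (m<n⇒m<1+n x<n)

sumBelow-+ : ∀ n (f g : ℕ → ℕ) → sumBelow n (λ x → f x + g x) ≡ sumBelow n f + sumBelow n g
sumBelow-+ zero    f g = refl
sumBelow-+ (suc n) f g = begin
  sumBelow n (λ x → f x + g x) + (f n + g n)     ≡⟨ cong (_+ (f n + g n)) (sumBelow-+ n f g) ⟩
  sumBelow n f + sumBelow n g + (f n + g n)      ≡⟨ +-exchange (sumBelow n f) (sumBelow n g) (f n) (g n) ⟩
  sumBelow n f + f n + (sumBelow n g + g n)      ∎
  where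
  open ≡-Reasoning
  +-exchange : ∀ a b c d → a + b + (c + d) ≡ a + c + (b + d)
  +-exchange = solve-∀

sumBelow-const : ∀ n c → sumBelow n (λ _ → c) ≡ n * c
sumBelow-const zero    c = refl
sumBelow-const (suc n) c = trans (cong (_+ c) (sumBelow-const n c)) (+-comm (n * c) c)

sumBelow-swapℕ : ∀ n p (f : ℕ → ℕ) → suc p < n → sumBelow n (f ∘ swapℕ p) ≡ sumBelow n f
sumBelow-swapℕ n p f 2+p≤n =
  subst (λ n → sumBelow n (f ∘ swapℕ p) ≡ sumBelow n f) (m+[n∸m]≡n 2+p≤n) (beyond (n ∸ suc (suc p)))
  where
  open ≡-Reasoning
  fixedBelow : ∀ x → x < p → f (swapℕ p x) ≡ f x
  fixedBelow x x<p = cong f (swapℕ-other p (<⇒≢ x<p) (<⇒≢ (m<n⇒m<1+n x<p)))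
  beyond : ∀ d → sumBelow (suc (suc p) + d) (f ∘ swapℕ p) ≡ sumBelow (suc (suc p) + d) f
  beyond zero rewrite +-identityʳ p = begin
    sumBelow p (f ∘ swapℕ p) + f (swapℕ p p) + f (swapℕ p (suc p))
      ≡⟨ cong₂ _+_ (cong₂ _+_ (sumBelow-cong p fixedBelow) (cong f (swapℕ-left p)))
                   (cong f (swapℕ-right p)) ⟩
    sumBelow p f + f (suc p) + f p        ≡⟨ +-exchangeʳ (sumBelow p f) (f (suc p)) (f p) ⟩
    sumBelow p f + f p + f (suc p)        ∎
    where
    +-exchangeʳ : ∀ a b c → a + b + c ≡ a + c + b
    +-exchangeʳ = solve-∀
  beyond (suc d) rewrite +-suc p d =
    cong₂ _+_ (beyond d) (cong f (swapℕ-other p (>⇒≢ (s≤s (m≤n⇒m≤1+n (m≤m+n p d)))) (>⇒≢ (s≤s (s≤s (m≤m+n p d))))))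

sumBelow² : ℕ → (ℕ → ℕ → ℕ) → ℕ
sumBelow² n F = sumBelow n λ x → sumBelow n (F x)

sumBelow²-cong : ∀ n {F G : ℕ → ℕ → ℕ} → (∀ x y → x < n → y < n → F x y ≡ G x y) →
                 sumBelow² n F ≡ sumBelow² n G
sumBelow²-cong n F≡G = sumBelow-cong n λ x x<n → sumBelow-cong n λ y y<n → F≡G x y x<n y<n

sumBelow²-+ : ∀ n (F G : ℕ → ℕ → ℕ) →
              sumBelow² n (λ x y → F x y + G x y) ≡ sumBelow² n F + sumBelow² n G
sumBelow²-+ n F G = trans (sumBelow-cong n λ x _ → sumBelow-+ n (F x) (G x))
                          (sumBelow-+ n (λ x → sumBelow n (F x)) (λ x → sumBelow n (G x)))

sumBelow²-swapℕ : ∀ n p (F : ℕ → ℕ → ℕ) → suc p < n →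
                  sumBelow² n (λ x y → F (swapℕ p x) (swapℕ p y)) ≡ sumBelow² n F
sumBelow²-swapℕ n p F 2+p≤n =
  trans (sumBelow-cong n λ x _ → sumBelow-swapℕ n p (F (swapℕ p x)) 2+p≤n)
        (sumBelow-swapℕ n p (λ x → sumBelow n (F x)) 2+p≤n)

sumBelow²-indicator : ∀ n {a b} (F : ℕ → ℕ → ℕ) → a < n → b < n →
                      sumBelow² n (λ x y → 𝟙 ((x ≟ a) ×-dec (y ≟ b)) * F x y) ≡ F a b
sumBelow²-indicator n {a} {b} F a<n b<n = begin
  sumBelow² n (λ x y → 𝟙 ((x ≟ a) ×-dec (y ≟ b)) * F x y)
    ≡⟨ sumBelow-single n a<n (λ x _ x≢a → sumBelow-≡0 n λ y _ → off x y (x≢a ∘ proj₁)) ⟩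
  sumBelow n (λ y → 𝟙 ((a ≟ a) ×-dec (y ≟ b)) * F a y)
    ≡⟨ sumBelow-single n b<n (λ y _ y≢b → off a y (y≢b ∘ proj₂)) ⟩
  𝟙 ((a ≟ a) ×-dec (b ≟ b)) * F a b
    ≡⟨ cong (_* F a b) (𝟙-yes ((a ≟ a) ×-dec (b ≟ b)) (refl , refl)) ⟩
  1 * F a b
    ≡⟨ *-identityˡ (F a b) ⟩
  F a b ∎
  where
  open ≡-Reasoning
  off : ∀ x y → ¬ (x ≡ a × y ≡ b) → 𝟙 ((x ≟ a) ×-dec (y ≟ b)) * F x y ≡ 0
  off x y ¬ab = cong (_* F x y) (𝟙-no ((x ≟ a) ×-dec (y ≟ b)) ¬ab)

inversions : ℕ → (ℕ → ℕ) → ℕ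
inversions n ρ = sumBelow² n λ x y → 𝟙 (x <? y) * 𝟙 (ρ y <? ρ x)

inversions-id : ∀ n → inversions n (λ x → x) ≡ 0
inversions-id n = sumBelow-≡0 n λ x _ → sumBelow-≡0 n λ y _ → noInversion x y
  where
  noInversion : ∀ x y → 𝟙 (x <? y) * 𝟙 (y <? x) ≡ 0
  noInversion x y with x <? y
  ... | yes x<y = cong (1 *_) (𝟙-no (y <? x) (<-asym x<y))
  ... | no _    = refl

orderedPairs : ∀ n → sumBelow² n (λ x y → 𝟙 (x <? y)) ≡ n C 2
orderedPairs zero    = refl
orderedPairs (suc n) = begin
  sumBelow (suc n) (λ x → sumBelow n (λ y → 𝟙 (x <? y)) + 𝟙 (x <? n))
    ≡⟨ cong₂ _+_ (sumBelow-cong n λ x x<n → cong (sumBelow n (λ y → 𝟙 (x <? y)) +_) (𝟙-yes (x <? n) x<n))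
                 (cong₂ _+_ (sumBelow-≡0 n λ y y<n → 𝟙-no (n <? y) (<-asym y<n)) (𝟙-no (n <? n) (<-irrefl refl))) ⟩
  sumBelow n (λ x → sumBelow n (λ y → 𝟙 (x <? y)) + 1) + 0
    ≡⟨ +-identityʳ _ ⟩
  sumBelow n (λ x → sumBelow n (λ y → 𝟙 (x <? y)) + 1)
    ≡⟨ sumBelow-+ n _ _ ⟩
  sumBelow² n (λ x y → 𝟙 (x <? y)) + sumBelow n (λ _ → 1)
    ≡⟨ cong₂ _+_ (orderedPairs n) (trans (sumBelow-const n 1) (*-identityʳ n)) ⟩
  n C 2 + n
    ≡⟨ trans (cong (n C 2 +_) (sym (nC1≡n n))) (trans (+-comm (n C 2) (n C 1)) (nCk+nC[k+1]≡[n+1]C[k+1] n 1)) ⟩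
  suc n C 2 ∎
  where open ≡-Reasoning

inversions-reverse : ∀ n (ρ : ℕ → ℕ) → (∀ x → x < n → ρ x ≡ n ∸ suc x) → inversions n ρ ≡ n C 2
inversions-reverse n ρ ρ-reverses = trans (sumBelow²-cong n inverted) (orderedPairs n)
  where
  inverted : ∀ x y → x < n → y < n → 𝟙 (x <? y) * 𝟙 (ρ y <? ρ x) ≡ 𝟙 (x <? y)
  inverted x y x<n y<n rewrite ρ-reverses x x<n | ρ-reverses y y<n with x <? y
  ... | yes x<y = trans (*-identityˡ _) (𝟙-yes (n ∸ suc y <? n ∸ suc x) (∸-monoʳ-< (s≤s x<y) y<n))
  ... | no _    = refl

inversions-swapℕ : ∀ n p (ρ : ℕ → ℕ) → suc p < n →
  inversions n (ρ ∘ swapℕ p) + 𝟙 (ρ (suc p) <? ρ p) ≡ inversions n ρ + 𝟙 (ρ p <? ρ (suc p))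
inversions-swapℕ n p ρ 2+p≤n = begin
  inversions n (ρ ∘ sw) + 𝟙 (ρ (suc p) <? ρ p)
    ≡⟨ cong₂ _+_ reindexed (sym (sumBelow²-indicator n R p<n 2+p≤n)) ⟩
  sumBelow² n (λ x y → 𝟙 (sw x <? sw y) * R x y) + sumBelow² n (λ x y → atPair x y * R x y)
    ≡⟨ sumBelow²-+ n _ _ ⟨
  sumBelow² n (λ x y → 𝟙 (sw x <? sw y) * R x y + atPair x y * R x y)
    ≡⟨ sumBelow²-cong n (λ x y _ _ → pointwise x y) ⟩
  sumBelow² n (λ x y → 𝟙 (x <? y) * R x y + atReversedPair x y * R x y)
    ≡⟨ sumBelow²-+ n _ _ ⟩
  inversions n ρ + sumBelow² n (λ x y → atReversedPair x y * R x y)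
    ≡⟨ cong (inversions n ρ +_) (sumBelow²-indicator n R 2+p≤n p<n) ⟩
  inversions n ρ + 𝟙 (ρ p <? ρ (suc p)) ∎
  where
  open ≡-Reasoning
  sw : ℕ → ℕ
  sw = swapℕ p
  p<n : p < n
  p<n = <-trans (n<1+n p) 2+p≤n
  R atPair atReversedPair : ℕ → ℕ → ℕ
  R x y = 𝟙 (ρ y <? ρ x)
  atPair x y = 𝟙 ((x ≟ p) ×-dec (y ≟ suc p))
  atReversedPair x y = 𝟙 ((x ≟ suc p) ×-dec (y ≟ p))
  pointwise : ∀ x y → 𝟙 (sw x <? sw y) * R x y + atPair x y * R x y ≡
                      𝟙 (x <? y) * R x y + atReversedPair x y * R x y
  pointwise x y = begin
    𝟙 (sw x <? sw y) * R x y + atPair x y * R x y  ≡⟨ *-distribʳ-+ (R x y) (𝟙 (sw x <? sw y)) (atPair x y) ⟨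
    (𝟙 (sw x <? sw y) + atPair x y) * R x y         ≡⟨ cong (_* R x y) (swapℕ-<-indicator p x y) ⟩
    (𝟙 (x <? y) + atReversedPair x y) * R x y       ≡⟨ *-distribʳ-+ (R x y) (𝟙 (x <? y)) (atReversedPair x y) ⟩
    𝟙 (x <? y) * R x y + atReversedPair x y * R x y ∎
  reindexed : inversions n (ρ ∘ sw) ≡ sumBelow² n (λ x y → 𝟙 (sw x <? sw y) * R x y)
  reindexed = trans
    (sumBelow²-cong n λ x y _ _ → cong (_* R (sw x) (sw y))
      (cong₂ (λ a b → 𝟙 (a <? b)) (sym (swapℕ-involutive p x)) (sym (swapℕ-involutive p y))))
    (sumBelow²-swapℕ n p (λ x y → 𝟙 (sw x <? sw y) * R x y) 2+p≤n)

module _ (f : ℕ → ℕ) (N : ℕ) (step≤1 : ∀ t → t < N → f (suc t) ≤ suc (f t)) where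

  growth≤distance : ∀ s d → s + d ≤ N → f (s + d) ≤ f s + d
  growth≤distance s zero    _ rewrite +-identityʳ s = ≤-reflexive (sym (+-identityʳ (f s)))
  growth≤distance s (suc d) s+d<N rewrite +-suc s d | +-suc (f s) d =
    ≤-trans (step≤1 (s + d) s+d<N) (s≤s (growth≤distance s d (<⇒≤ s+d<N)))

  full-growth⇒increasing : f 0 ≡ 0 → N ≤ f N → ∀ t → t < N → f t < f (suc t)
  full-growth⇒increasing f0≡0 N≤fN t t<N with f t <? f (suc t)
  ... | yes ft<ft+1 = ft<ft+1
  ... | no ft≮ft+1  = contradiction N≤fN (<⇒≱ (begin-strict
    f N                                ≡⟨ cong f (m+[n∸m]≡n t<N) ⟨
    f (suc t + (N ∸ suc t))            ≤⟨ growth≤distance (suc t) (N ∸ suc t) (≤-reflexive (m+[n∸m]≡n t<N)) ⟩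
    f (suc t) + (N ∸ suc t)            ≤⟨ +-monoˡ-≤ (N ∸ suc t) (≮⇒≥ ft≮ft+1) ⟩
    f t + (N ∸ suc t)                  ≤⟨ +-monoˡ-≤ (N ∸ suc t) ft≤t ⟩
    t + (N ∸ suc t)                    <⟨ n<1+n _ ⟩
    suc t + (N ∸ suc t)                ≡⟨ m+[n∸m]≡n t<N ⟩
    N                                  ∎))
    where
    open ≤-Reasoning
    ft≤t : f t ≤ t
    ft≤t = ≤-trans (growth≤distance 0 t (<⇒≤ t<N)) (≤-reflexive (cong (_+ t) f0≡0))

-- Counting by injections

∈-remove : ∀ {A : Set} {y : A} {ys} → y ∈ ys →
           ∃ λ zs → length ys ≡ suc (length zs) × (∀ {z} → z ∈ ys → z ≢ y → z ∈ zs)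
∈-remove {ys = _ ∷ ys} (here refl) = ys , refl , λ
  { (here refl) z≢y → contradiction refl z≢y
  ; (there z∈ys) _  → z∈ys }
∈-remove {ys = w ∷ ys} (there y∈ys) with zs , eq , keep ← ∈-remove y∈ys = w ∷ zs , cong suc eq , λ
  { (here refl) _     → here refl
  ; (there z∈ys) z≢y  → there (keep z∈ys z≢y) }

length-≤-injection : ∀ {A B : Set} (f : A → B) {xs : List A} {ys : List B} → Unique xs →
  (∀ {x} → x ∈ xs → f x ∈ ys) → (∀ {x y} → x ∈ xs → y ∈ xs → f x ≡ f y → x ≡ y) →
  length xs ≤ length ys
length-≤-injection f {[]}     _               _    _   = z≤n
length-≤-injection f {x ∷ xs} {ys} (x∉xs ∷ unique) into inj
  with zs , eq , keep ← ∈-remove (into (here refl)) =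
  subst (suc (length xs) ≤_) (sym eq) (s≤s (length-≤-injection f unique
    (λ x′∈xs → keep (into (there x′∈xs)) (λ fx′≡fx →
      All.lookup x∉xs x′∈xs (inj (here refl) (there x′∈xs) (sym fx′≡fx))))
    (λ x′∈xs y′∈xs → inj (there x′∈xs) (there y′∈xs))))

count : {P : ℕ → Set} → Decidable P → ℕ → ℕ
count P? M = length (filter P? (upTo M))

count-suc : ∀ {P : ℕ → Set} (P? : Decidable P) M → count P? (suc M) ≡ count P? M + 𝟙 (P? M)
count-suc P? M = begin
  length (filter P? (upTo (suc M)))                   ≡⟨ cong (length ∘ filter P?) (upTo-∷ʳ M) ⟨
  length (filter P? (upTo M ++ [ M ]))                ≡⟨ cong length (filter-++ P? (upTo M) [ M ]) ⟩
  length (filter P? (upTo M) ++ filter P? [ M ])      ≡⟨ length-++ (filter P? (upTo M)) ⟩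
  count P? M + length (filter P? [ M ])               ≡⟨ cong (count P? M +_) single ⟩
  count P? M + 𝟙 (P? M)                               ∎
  where
  open ≡-Reasoning
  single : length (filter P? [ M ]) ≡ 𝟙 (P? M)
  single with P? M
  ... | yes _ = refl
  ... | no _  = refl

count-≤-length : ∀ {P : ℕ → Set} (P? : Decidable P) (f : ℕ → ℕ) {M} {ys : List ℕ} →
  (∀ {x} → x < M → P x → f x ∈ ys) → (∀ {x y} → x < M → y < M → P x → P y → f x ≡ f y → x ≡ y) →
  count P? M ≤ length ys
count-≤-length {P} P? f {M} into inj = length-≤-injection f (filter⁺ P? (upTo⁺ M))
  (λ x∈ → into (proj₁ (member x∈)) (proj₂ (member x∈)))
  (λ x∈ y∈ → inj (proj₁ (member x∈)) (proj₁ (member y∈)) (proj₂ (member x∈)) (proj₂ (member y∈)))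
  where
  member : ∀ {x} → x ∈ filter P? (upTo M) → x < M × P x
  member x∈ with x∈M , Px ← ∈-filter⁻ P? {xs = upTo M} x∈ = ∈-upTo⁻ x∈M , Px

count-≤-injection : ∀ {P Q : ℕ → Set} (P? : Decidable P) (Q? : Decidable Q) (f : ℕ → ℕ) {M M′} →
  (∀ {x} → x < M → P x → f x < M′ × Q (f x)) →
  (∀ {x y} → x < M → y < M → P x → P y → f x ≡ f y → x ≡ y) →
  count P? M ≤ count Q? M′
count-≤-injection P? Q? f into inj = count-≤-length P? f
  (λ x<M Px → ∈-filter⁺ Q? (∈-upTo⁺ (proj₁ (into x<M Px))) (proj₂ (into x<M Px))) inj

-- Halfperiods

module HalfperiodDynamics {n} (H : Halfperiod n) where
  open Halfperiod H

  N : ℕ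
  N = n C 2

  -- origin t q is the position in π 0 of the element at position q of π t,
  -- and track t x is the position in π t of the element at position x of π 0.
  origin : ℕ → ℕ → ℕ
  origin zero    q = q
  origin (suc t) q = origin t (swapℕ (pos t) q)

  track : ℕ → ℕ → ℕ
  track zero    x = x
  track (suc t) x = swapℕ (pos t) (track t x)

  origin-track : ∀ t x → origin t (track t x) ≡ x
  origin-track zero    x = refl
  origin-track (suc t) x =
    trans (cong (origin t) (swapℕ-involutive (pos t) (track t x))) (origin-track t x)

  origin-injective : ∀ t {q q′} → origin t q ≡ origin t q′ → q ≡ q′
  origin-injective zero    eq = eq
  origin-injective (suc t) eq = swapℕ-injective (pos t) (origin-injective t eq)

  2+pos≤n : ∀ t → t < N → suc (pos t) < n
  2+pos≤n t t<N = proj₁ (step t t<N)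

  pos<n : ∀ t → t < N → pos t < n
  pos<n t t<N = <-trans (n<1+n (pos t)) (2+pos≤n t t<N)

  origin-< : ∀ t → t ≤ N → ∀ {q} → q < n → origin t q < n
  origin-< zero    _   q<n = q<n
  origin-< (suc t) t<N q<n = origin-< t (<⇒≤ t<N) (swapℕ-< (pos t) (2+pos≤n t t<N) q<n)

  track-< : ∀ t → t ≤ N → ∀ {x} → x < n → track t x < n
  track-< zero    _   x<n = x<n
  track-< (suc t) t<N x<n = swapℕ-< (pos t) (2+pos≤n t t<N) (track-< t (<⇒≤ t<N) x<n)

  π-origin : ∀ t → t ≤ N → ∀ (q x : Fin n) → toℕ x ≡ origin t (toℕ q) → π t q ≡ π 0 x
  π-origin zero    _   q x x≡q = cong (π 0) (toℕ-injective (sym x≡q))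
  π-origin (suc t) t<N q x x≡o = trans (proj₂ (step t t<N) q q′ (toℕ-fromℕ< _))
    (π-origin t (<⇒≤ t<N) q′ x (trans x≡o (cong (origin t) (sym (toℕ-fromℕ< _)))))
    where
    q′ : Fin n
    q′ = fromℕ< (swapℕ-< (pos t) (2+pos≤n t t<N) (toℕ<n q))

  origin-π : ∀ t → t ≤ N → ∀ (q x : Fin n) → π t q ≡ π 0 x → origin t (toℕ q) ≡ toℕ x
  origin-π t t≤N q x πtq≡π0x = begin
    origin t (toℕ q)  ≡⟨ toℕ-fromℕ< o<n ⟨
    toℕ (fromℕ< o<n)  ≡⟨ cong toℕ (perm 0 z≤n (trans (sym (π-origin t t≤N q _ (toℕ-fromℕ< o<n))) πtq≡π0x)) ⟩
    toℕ x             ∎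
    where
    open ≡-Reasoning
    o<n : origin t (toℕ q) < n
    o<n = origin-< t t≤N (toℕ<n q)

  origin-final : ∀ {x} → x < n → origin N x ≡ n ∸ suc x
  origin-final {x} x<n = begin
    origin N x                  ≡⟨ cong (origin N) (toℕ-fromℕ< x<n) ⟨
    origin N (toℕ (fromℕ< x<n)) ≡⟨ origin-π N ≤-refl _ _ (rev _ _ positionsSum) ⟩
    toℕ (fromℕ< n∸1+x<n)        ≡⟨ toℕ-fromℕ< n∸1+x<n ⟩
    n ∸ suc x                   ∎
    where
    open ≡-Reasoning
    n∸1+x<n : n ∸ suc x < n
    n∸1+x<n = ∸-monoʳ-< {o = 0} (s≤s z≤n) x<n
    positionsSum : suc (toℕ (fromℕ< x<n) + toℕ (fromℕ< n∸1+x<n)) ≡ n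
    positionsSum = trans (cong₂ (λ a b → suc (a + b)) (toℕ-fromℕ< x<n) (toℕ-fromℕ< n∸1+x<n))
                         (m+[n∸m]≡n x<n)

  inversionsAt : ℕ → ℕ
  inversionsAt t = inversions n (origin t)

  inversionsAt-step : ∀ t → t < N →
    inversionsAt (suc t) + 𝟙 (origin t (suc (pos t)) <? origin t (pos t)) ≡
    inversionsAt t + 𝟙 (origin t (pos t) <? origin t (suc (pos t)))
  inversionsAt-step t t<N = inversions-swapℕ n (pos t) (origin t) (2+pos≤n t t<N)

  -- The inversion count starts at 0, ends at N = n C 2 and moves by one per step.
  inversionsAt-increases : ∀ t → t < N → inversionsAt t < inversionsAt (suc t)
  inversionsAt-increases = full-growth⇒increasing inversionsAt N step≤1
    (inversions-id n) (≤-reflexive (sym (inversions-reverse n (origin N) (λ _ → origin-final))))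
    where
    step≤1 : ∀ t → t < N → inversionsAt (suc t) ≤ suc (inversionsAt t)
    step≤1 t t<N = ≤-trans (m≤m+n _ _) (≤-trans (≤-reflexive (inversionsAt-step t t<N))
      (≤-trans (+-monoʳ-≤ (inversionsAt t) (𝟙≤1 _)) (≤-reflexive (+-comm (inversionsAt t) 1))))

  steps-ascend : ∀ t → t < N → origin t (pos t) < origin t (suc (pos t))
  steps-ascend t t<N with origin t (pos t) <? origin t (suc (pos t))
  ... | yes ascending = ascending
  ... | no ¬ascending = contradiction (inversionsAt-increases t t<N) (≤⇒≯ descent)
    where
    descent : inversionsAt (suc t) ≤ inversionsAt t
    descent = ≤-trans (m≤m+n _ _) (≤-reflexive (trans (inversionsAt-step t t<N)
                (trans (cong (inversionsAt t +_) (𝟙-no _ ¬ascending)) (+-identityʳ _))))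

  track-origin : ∀ t q → track t (origin t q) ≡ q
  track-origin t q = origin-injective t (origin-track t (origin t q))

  track-final : ∀ {x} → x < n → suc (track N x) + x ≡ n
  track-final {x} x<n = begin
    suc (track N x) + x                       ≡⟨ cong (suc (track N x) +_) x≡n∸1+P ⟩
    suc (track N x) + (n ∸ suc (track N x))   ≡⟨ m+[n∸m]≡n (track-< N ≤-refl x<n) ⟩
    n                                         ∎
    where
    open ≡-Reasoning
    x≡n∸1+P : x ≡ n ∸ suc (track N x)
    x≡n∸1+P = trans (sym (origin-track N x)) (origin-final (track-< N ≤-refl x<n))

  -- Steps only transpose ascending pairs, so an inverted pair is never transposed back.
  inversion-persists : ∀ {x y} → y < x → ∀ t d → t + d ≤ N →
                       track t x < track t y → track (t + d) x < track (t + d) y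
  inversion-persists y<x t zero    _       inverted rewrite +-identityʳ t = inverted
  inversion-persists {x} {y} y<x t (suc d) t+d<N inverted rewrite +-suc t d =
    swapℕ-mono-< (pos (t + d)) (inversion-persists y<x t d (<⇒≤ t+d<N) inverted) ascendingSwap
    where
    ascendingSwap : ¬ (track (t + d) x ≡ pos (t + d) × track (t + d) y ≡ suc (pos (t + d)))
    ascendingSwap (x≡p , y≡1+p) = <-asym y<x (subst₂ _<_
      (trans (cong (origin (t + d)) (sym x≡p)) (origin-track (t + d) x))
      (trans (cong (origin (t + d)) (sym y≡1+p)) (origin-track (t + d) y))
      (steps-ascend (t + d) t+d<N))

-- The digraph D_k

module _ (m : ℕ) (H : Halfperiod (3 * m)) where
  open Halfperiod H
  open HalfperiodDynamics H

  outdeg≤ : ∀ k i → outdeg m H k i ≤ m ∸ i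
  outdeg≤ k i = subst (outdeg m H k i ≤_) (length-upTo (m ∸ i))
    (count-≤-length (edge? m H k i) (_∸ suc i) into injective)
    where
    into : ∀ {j} → j < suc m → Edge m H k i j → j ∸ suc i ∈ upTo (m ∸ i)
    into _ (i<j , j≤m , _) = ∈-upTo⁺ (subst (_≤ m ∸ i) (+-∸-assoc 1 i<j) (∸-monoˡ-≤ i j≤m))
    injective : ∀ {j j′} → j < suc m → j′ < suc m → Edge m H k i j → Edge m H k i j′ →
                j ∸ suc i ≡ j′ ∸ suc i → j ≡ j′
    injective _ _ (i<j , _) (i<j′ , _) = ∸-cancelʳ-≡ i<j i<j′

  swapped-ascending : ∀ {t} → t < N → (qx qy : Fin (3 * m)) → toℕ qx < toℕ qy →
    Swapped m H (π 0 qx) (π 0 qy) t → origin t (pos t) ≡ toℕ qx × origin t (suc (pos t)) ≡ toℕ qy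
  swapped-ascending {t} t<N qx qy x<y (q , q′ , q≡p , q′≡1+p , inj₁ (πq≡x , πq′≡y)) =
    trans (cong (origin t) (sym q≡p)) (origin-π t (<⇒≤ t<N) q qx πq≡x) ,
    trans (cong (origin t) (sym q′≡1+p)) (origin-π t (<⇒≤ t<N) q′ qy πq′≡y)
  swapped-ascending {t} t<N qx qy x<y (q , q′ , q≡p , q′≡1+p , inj₂ (πq≡y , πq′≡x)) =
    contradiction (subst₂ _<_
      (trans (cong (origin t) (sym q≡p)) (origin-π t (<⇒≤ t<N) q qy πq≡y))
      (trans (cong (origin t) (sym q′≡1+p)) (origin-π t (<⇒≤ t<N) q′ qx πq′≡x))
      (steps-ascend t t<N)) (<-asym x<y)

  module CentreMoves (k a : ℕ) (a<k : a < k) (2k<3m : 2 * k < 3 * m) (a<m : a < m) where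

    w : ℕ
    w = 3 * m ∸ 2 * k ∸ 1

    a<3m : a < 3 * m
    a<3m = <-≤-trans a<m (m≤n*m m 3)

    3m∸k≡1+k+w : 3 * m ∸ k ≡ suc (k + w)
    3m∸k≡1+k+w = begin
      3 * m ∸ k                                    ≡⟨ cong (_∸ k) (m+[n∸m]≡n 2k<3m) ⟨
      (suc (2 * k) + (3 * m ∸ suc (2 * k))) ∸ k    ≡⟨ cong (λ d → (suc (2 * k) + d) ∸ k) 3m∸1+2k≡w ⟩
      (suc (2 * k) + w) ∸ k                        ≡⟨ cong (_∸ k) (regroup k w) ⟩
      (k + suc (k + w)) ∸ k                        ≡⟨ m+n∸m≡n k (suc (k + w)) ⟩
      suc (k + w)                                  ∎
      where
      open ≡-Reasoning
      3m∸1+2k≡w : 3 * m ∸ suc (2 * k) ≡ w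
      3m∸1+2k≡w = trans (cong (3 * m ∸_) (+-comm 1 (2 * k))) (sym (∸-+-assoc (3 * m) (2 * k) 1))
      regroup : ∀ k w → suc (2 * k) + w ≡ k + suc (k + w)
      regroup = solve-∀

    inCentre? : ∀ p → Dec (InCenter m H k p)
    inCentre? p = (k <? suc p) ×-dec (suc p <? 3 * m ∸ k)

    inCentre⇒ : ∀ {p} → k ≤ p → InCenter m H k p → p ∸ k < w
    inCentre⇒ {p} k≤p (_ , 1+p<3m∸k) = +-cancelˡ-< k (p ∸ k) w (subst (_< k + w) (sym (m+[n∸m]≡n k≤p))
      (≤-pred (subst (suc p <_) 3m∸k≡1+k+w 1+p<3m∸k)))

    inCentre⇐ : ∀ {p} → k ≤ p → p ∸ k < w → InCenter m H k p
    inCentre⇐ {p} k≤p p∸k<w = s≤s k≤p , subst (suc p <_) (sym 3m∸k≡1+k+w)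
      (s≤s (subst (_< k + w) (m+[n∸m]≡n k≤p) (+-monoʳ-< k p∸k<w)))

    -- The number of centre positions p < P, the centre being k ≤ p < k + w.
    centreBelow : ℕ → ℕ
    centreBelow P = (P ∸ k) ⊓ w

    centreBelow-suc : ∀ p → centreBelow (suc p) ≡ centreBelow p + 𝟙 (inCentre? p)
    centreBelow-suc p with k ≤? p
    ... | no k≰p rewrite m≤n⇒m∸n≡0 (≰⇒> k≰p) | m≤n⇒m∸n≡0 (<⇒≤ (≰⇒> k≰p))
      = sym (𝟙-no (inCentre? p) (k≰p ∘ ≤-pred ∘ proj₁))
    ... | yes k≤p rewrite +-∸-assoc 1 k≤p with p ∸ k <? w
    ...   | yes p∸k<w = begin
      suc (p ∸ k) ⊓ w            ≡⟨ m≤n⇒m⊓n≡m p∸k<w ⟩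
      suc (p ∸ k)                ≡⟨ +-comm 1 (p ∸ k) ⟩
      p ∸ k + 1                  ≡⟨ cong₂ _+_ (m≤n⇒m⊓n≡m (<⇒≤ p∸k<w)) (𝟙-yes (inCentre? p) (inCentre⇐ k≤p p∸k<w)) ⟨
      (p ∸ k) ⊓ w + 𝟙 (inCentre? p) ∎
      where open ≡-Reasoning
    ...   | no p∸k≮w = begin
      suc (p ∸ k) ⊓ w            ≡⟨ m≥n⇒m⊓n≡n (m≤n⇒m≤1+n (≮⇒≥ p∸k≮w)) ⟩
      w                          ≡⟨ +-identityʳ w ⟨
      w + 0                      ≡⟨ cong₂ _+_ (m≥n⇒m⊓n≡n (≮⇒≥ p∸k≮w)) (𝟙-no (inCentre? p) (p∸k≮w ∘ inCentre⇒ k≤p)) ⟨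
      (p ∸ k) ⊓ w + 𝟙 (inCentre? p) ∎
      where open ≡-Reasoning

    centreBelow-swapℕ : ∀ p q →
      centreBelow q + 𝟙 ((q ≟ p) ×-dec inCentre? p) ≡
      𝟙 ((q ≟ suc p) ×-dec inCentre? p) + centreBelow (swapℕ p q)
    centreBelow-swapℕ p q with swapℕ p q | swapℕ-view p q
    ... | _ | left = begin
      centreBelow p + 𝟙 ((p ≟ p) ×-dec inCentre? p)  ≡⟨ cong (centreBelow p +_) (𝟙-cong _ (inCentre? p) proj₂ (refl ,_)) ⟩
      centreBelow p + 𝟙 (inCentre? p)                ≡⟨ centreBelow-suc p ⟨
      centreBelow (suc p)                            ≡⟨ cong (_+ centreBelow (suc p)) (𝟙-no _ (1+n≢n ∘ sym ∘ proj₁)) ⟨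
      𝟙 ((p ≟ suc p) ×-dec inCentre? p) + centreBelow (suc p) ∎
      where open ≡-Reasoning
    ... | _ | right = begin
      centreBelow (suc p) + 𝟙 ((suc p ≟ p) ×-dec inCentre? p) ≡⟨ cong (centreBelow (suc p) +_) (𝟙-no _ (1+n≢n ∘ proj₁)) ⟩
      centreBelow (suc p) + 0                        ≡⟨ +-identityʳ _ ⟩
      centreBelow (suc p)                            ≡⟨ centreBelow-suc p ⟩
      centreBelow p + 𝟙 (inCentre? p)                ≡⟨ +-comm (centreBelow p) _ ⟩
      𝟙 (inCentre? p) + centreBelow p                ≡⟨ cong (_+ centreBelow p) (𝟙-cong _ (inCentre? p) proj₂ (refl ,_)) ⟨
      𝟙 ((suc p ≟ suc p) ×-dec inCentre? p) + centreBelow p ∎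
      where open ≡-Reasoning
    ... | _ | other q≢p q≢1+p
      rewrite 𝟙-no ((q ≟ p) ×-dec inCentre? p) (q≢p ∘ proj₁)
            | 𝟙-no ((q ≟ suc p) ×-dec inCentre? p) (q≢1+p ∘ proj₁) = +-identityʳ (centreBelow q)

    RightMove LeftMove : ℕ → Set
    RightMove t = track t a ≡ pos t × InCenter m H k (pos t)
    LeftMove  t = track t a ≡ suc (pos t) × InCenter m H k (pos t)

    rightMove? : Decidable RightMove
    rightMove? t = (track t a ≟ pos t) ×-dec inCentre? (pos t)

    leftMove? : Decidable LeftMove
    leftMove? t = (track t a ≟ suc (pos t)) ×-dec inCentre? (pos t)

    moves-balance : ∀ T → count rightMove? T ≡ count leftMove? T + centreBelow (track T a)
    moves-balance zero    = cong (_⊓ w) (sym (m≤n⇒m∸n≡0 (<⇒≤ a<k)))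
    moves-balance (suc T) = begin
      count rightMove? (suc T)                                            ≡⟨ count-suc rightMove? T ⟩
      count rightMove? T + 𝟙 (rightMove? T)                               ≡⟨ cong (_+ 𝟙 (rightMove? T)) (moves-balance T) ⟩
      count leftMove? T + centreBelow (track T a) + 𝟙 (rightMove? T)      ≡⟨ +-assoc (count leftMove? T) _ _ ⟩
      count leftMove? T + (centreBelow (track T a) + 𝟙 (rightMove? T))   ≡⟨ cong (count leftMove? T +_) (centreBelow-swapℕ (pos T) (track T a)) ⟩
      count leftMove? T + (𝟙 (leftMove? T) + centreBelow (track (suc T) a)) ≡⟨ +-assoc (count leftMove? T) _ _ ⟨
      count leftMove? T + 𝟙 (leftMove? T) + centreBelow (track (suc T) a) ≡⟨ cong (_+ centreBelow (track (suc T) a)) (count-suc leftMove? T) ⟨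
      count leftMove? (suc T) + centreBelow (track (suc T) a)             ∎
      where open ≡-Reasoning

    centreBelow-final : centreBelow (track N a) ≡ w
    centreBelow-final = m≥n⇒m⊓n≡n (subst (_≤ track N a ∸ k) (m+n∸m≡n k w) (∸-monoˡ-≤ k k+w≤P))
      where
      k+w≤P : k + w ≤ track N a
      k+w≤P = ≤-pred (+-cancelʳ-≤ k (suc (k + w)) (suc (track N a)) (begin
        suc (k + w) + k            ≡⟨ cong (_+ k) 3m∸k≡1+k+w ⟨
        3 * m ∸ k + k              ≡⟨ m∸n+n≡m (≤-trans (m≤m+n k (k + 0)) (<⇒≤ 2k<3m)) ⟩
        3 * m                      ≡⟨ track-final a<3m ⟨
        suc (track N a) + a        ≤⟨ +-monoʳ-≤ (suc (track N a)) (<⇒≤ a<k) ⟩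
        suc (track N a) + k        ∎))
        where open ≤-Reasoning

    rightMoves≡leftMoves+w : count rightMove? N ≡ count leftMove? N + w
    rightMoves≡leftMoves+w = trans (moves-balance N) (cong (count leftMove? N +_) centreBelow-final)

    outEdge-rightMove : ∀ {j} → Edge m H k (suc a) j →
      Σ ℕ λ t → (t < N × RightMove t) × suc (origin t (suc (pos t))) ≡ j
    outEdge-rightMove (a<j , _ , qi , qj , 1+qi≡1+a , 1+qj≡j , T , swapped , centre) =
      toℕ T , (toℕ<n T , trackAtLeft , centre) , trans (cong suc (proj₂ swappedPair)) 1+qj≡j
      where
      swappedPair : origin (toℕ T) (pos (toℕ T)) ≡ toℕ qi × origin (toℕ T) (suc (pos (toℕ T))) ≡ toℕ qj
      swappedPair = swapped-ascending (toℕ<n T) qi qj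
        (≤-pred (subst₂ _<_ (sym 1+qi≡1+a) (sym 1+qj≡j) a<j)) swapped
      trackAtLeft : track (toℕ T) a ≡ pos (toℕ T)
      trackAtLeft = trans (cong (track (toℕ T)) (trans (sym (suc-injective 1+qi≡1+a)) (sym (proj₁ swappedPair))))
                          (track-origin (toℕ T) (pos (toℕ T)))

    outEdgeTime : ℕ → ℕ
    outEdgeTime j with edge? m H k (suc a) j
    ... | yes e = proj₁ (outEdge-rightMove e)
    ... | no _  = 0

    outEdgeTime-rightMove : ∀ {j} → Edge m H k (suc a) j →
      (outEdgeTime j < N × RightMove (outEdgeTime j)) × suc (origin (outEdgeTime j) (suc (pos (outEdgeTime j)))) ≡ j
    outEdgeTime-rightMove {j} e with edge? m H k (suc a) j
    ... | yes e′ = proj₂ (outEdge-rightMove e′)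
    ... | no ¬e  = contradiction e ¬e

    outdeg≤rightMoves : outdeg m H k (suc a) ≤ count rightMove? N
    outdeg≤rightMoves = count-≤-injection (edge? m H k (suc a)) rightMove? outEdgeTime {suc m} {N}
      (λ _ e → proj₁ (outEdgeTime-rightMove e))
      (λ _ _ e e′ same → trans (sym (proj₂ (outEdgeTime-rightMove e)))
                         (trans (cong (λ t → suc (origin t (suc (pos t)))) same) (proj₂ (outEdgeTime-rightMove e′))))

    partner : ℕ → ℕ
    partner t = origin t (pos t)

    leftMove-origin : ∀ {t} → LeftMove t → origin t (suc (pos t)) ≡ a
    leftMove-origin {t} (atRight , _) = trans (cong (origin t) (sym atRight)) (origin-track t a)

    partner<a : ∀ {t} → t < N → LeftMove t → partner t < a
    partner<a {t} t<N move = subst (partner t <_) (leftMove-origin move) (steps-ascend t t<N)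

    leftMove-inEdge : ∀ {t} → t < N → LeftMove t → Edge m H k (suc (partner t)) (suc a)
    leftMove-inEdge {t} t<N move@(_ , centre) =
      s≤s (partner<a t<N move) , a<m , qi , qj , cong suc (toℕ-fromℕ< _) , cong suc (toℕ-fromℕ< a<3m) ,
      fromℕ< t<N , subst (λ s → Swapped m H (π 0 qi) (π 0 qj) s × InCenter m H k (pos s))
                         (sym (toℕ-fromℕ< t<N)) (swapped , centre)
      where
      q q′ qi qj : Fin (3 * m)
      q  = fromℕ< (pos<n t t<N)
      q′ = fromℕ< (2+pos≤n t t<N)
      qi = fromℕ< (origin-< t (<⇒≤ t<N) (pos<n t t<N))
      qj = fromℕ< a<3m
      swapped : Swapped m H (π 0 qi) (π 0 qj) t
      swapped = q , q′ , toℕ-fromℕ< _ , toℕ-fromℕ< _ , inj₁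
        ( π-origin t (<⇒≤ t<N) q qi (trans (toℕ-fromℕ< _) (cong (origin t) (sym (toℕ-fromℕ< _))))
        , π-origin t (<⇒≤ t<N) q′ qj (trans (toℕ-fromℕ< a<3m)
            (trans (sym (leftMove-origin move)) (cong (origin t) (sym (toℕ-fromℕ< _))))))

    -- Once a has passed b leftwards, a stays left of b.
    partners-distinct : ∀ {t t′} → t < t′ → t′ < N → LeftMove t → LeftMove t′ → partner t ≢ partner t′
    partners-distinct {t} {t′} t<t′ t′<N move@(atRight , _) (atRight′ , _) same =
      <-asym (subst₂ _<_ atRight′ partnerAtLeft stillLeft) (n<1+n (pos t′))
      where
      b : ℕ
      b = partner t
      stillLeft : track t′ a < track t′ b
      stillLeft = subst (λ s → track s a < track s b) (m+[n∸m]≡n t<t′)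
        (inversion-persists (partner<a (<-trans t<t′ t′<N) move) (suc t) (t′ ∸ suc t)
          (≤-trans (≤-reflexive (m+[n∸m]≡n t<t′)) (<⇒≤ t′<N))
          (subst₂ _<_ (sym (trans (cong (swapℕ (pos t)) atRight) (swapℕ-right (pos t))))
                      (sym (trans (cong (swapℕ (pos t)) (track-origin t (pos t))) (swapℕ-left (pos t))))
                      (n<1+n (pos t))))
      partnerAtLeft : track t′ b ≡ pos t′
      partnerAtLeft = trans (cong (track t′) same) (track-origin t′ (pos t′))

    leftMoves≤indeg : count leftMove? N ≤ indeg m H k (suc a)
    leftMoves≤indeg = count-≤-injection leftMove? (λ j → edge? m H k j (suc a)) (suc ∘ partner) {N} {suc m}
      (λ t<N move → let e = leftMove-inEdge t<N move in <-≤-trans (proj₁ e) (m≤n⇒m≤1+n a<m) , e)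
      injective
      where
      injective : ∀ {t t′} → t < N → t′ < N → LeftMove t → LeftMove t′ → suc (partner t) ≡ suc (partner t′) → t ≡ t′
      injective {t} {t′} t<N t′<N move move′ same with <-cmp t t′
      ... | tri< t<t′ _ _ = contradiction (suc-injective same) (partners-distinct t<t′ t′<N move move′)
      ... | tri≈ _ t≡t′ _ = t≡t′
      ... | tri> _ _ t′<t = contradiction (sym (suc-injective same)) (partners-distinct t′<t t<N move′ move)

lemma1 : (m k : ℕ) → 0 < m → m < k → 2 * k < 3 * m →
         (H : Halfperiod (3 * m)) → ThreeDecomposable m H →
         (i : ℕ) → 1 ≤ i → i ≤ m →
         outdeg m H k i ≤ (3 * m ∸ 2 * k ∸ 1 + indeg m H k i) ⊓ (m ∸ i)
lemma1 m k _ m<k 2k<3m H _ (suc a) _ 1+a≤m = ⊓-glb (begin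
  outdeg m H k (suc a)          ≤⟨ outdeg≤rightMoves ⟩
  count rightMove? N            ≡⟨ rightMoves≡leftMoves+w ⟩
  count leftMove? N + w         ≤⟨ +-monoˡ-≤ w leftMoves≤indeg ⟩
  indeg m H k (suc a) + w       ≡⟨ +-comm _ w ⟩
  w + indeg m H k (suc a)       ∎)
  (outdeg≤ m H k (suc a))
  where
  open ≤-Reasoning
  open HalfperiodDynamics H using (N)
  open CentreMoves m H k a (≤-trans 1+a≤m (<⇒≤ m<k)) 2k<3m 1+a≤m
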